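{- Let $d\ge2$, $p\ge1$, $k\ge1$. Define the function on $\mathcal{C}_k^{(d)}$ $$\psi:=\frac{1}{dk+1}\sum_{j\ge p}\ \sum_{v\in\{1,\dots,d\}^j}\ \sum_{\substack{\mathcal{S}=\mathrm{Sh}(T;v_0,\dots,v_p=v)\\\text{for some }T\in\mathcal{C}_k^{(d)}}}\mathbf{1}_\mathcal{S}.$$ Then $\psi$ lies in the span of the indicator functions of length-$p$ shuffle classes in $\mathcal{C}_k^{(d)}$, and $$\sup_{T\in\mathcal{C}_k^{(d)}}|\psi(T)-1|\le\frac{C_{d,p}}{dk+1},\qquad C_{d,p}:=\frac{d^p-1}{d-1}.$$
   Context: A $d$-Catalan tree is a rooted planar tree in which every vertex has $0$ or $d$ children; $\mathcal{C}_k^{(d)}$ is the set of such trees with $k$ internal vertices. Vertices are identified with codes in $\bigcup_{j\ge0}\{1,\dots,d\}^j$: the root is the empty code and the children of the vertex with code $u$, from left to right, have codes $u1,\dots,ud$; the code length equals the height. For a vertex $v$ of height at least $p$ in $T$, $(v_0,\dots,v_p)$ denotes the unique ancestral path ending at $v_p=v$ (each $v_i$ the parent of $v_{i+1}$), and $\mathrm{Sh}(T;v_0,\dots,v_p)$ is the shuffle class: the set of trees in $\mathcal{C}_k^{(d)}$ obtainable from $T$ by rearranging the $(d-1)p$ subtrees subtended by the siblings of $v_1,\dots,v_p$ among these sibling positions. A length-$p$ shuffle class is any such set. The innermost sum runs over the distinct sets $\mathcal{S}$ arising as $\mathrm{Sh}(T;v_0,\dots,v_p)$ for some $T\in\mathcal{C}_k^{(d)}$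 containing the code $v$, with $v_p$ the vertex of code $v$. -}

module Defs where

open import Data.Bool using (Bool; true; false; _∧_; if_then_else_; not)
open import Data.Nat as ℕ using (ℕ; zero; suc; _+_; _*_; _∸_; _^_; _≟_)
open import Data.Fin as Fin using (Fin)
import Data.Fin.Properties as FinP
open import Data.Vec as Vec using (Vec; []; _∷_; lookup; updateAt)
open import Data.List as List
  using (List; []; _∷_; map; concatMap; filterᵇ; allFin; upTo; length; take; drop; _++_; [_]; mapMaybe; foldr; deduplicateᵇ)
open import Data.Bool.ListAction using (all; any)
open import Data.Nat.ListAction using (sum)
open import Data.Maybe using (Maybe; just; nothing; is-just)
open import Data.Product using (_×_; _,_)
open import Data.Integer using (+_)
open import Data.Rational using (ℚ; _/_; 0ℚ; 1ℚ)
import Data.Rational as ℚ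
open import Relation.Nullary.Decidable using (⌊_⌋)

data Tree (d : ℕ) : Set where
  leaf : Tree d
  node : Vec (Tree d) d → Tree d

mutual
  internal : ∀ {d} → Tree d → ℕ
  internal leaf      = 0
  internal (node ts) = suc (internalV ts)

  internalV : ∀ {d n} → Vec (Tree d) n → ℕ
  internalV []       = 0
  internalV (t ∷ ts) = internal t + internalV ts

_∈C_ : ∀ {d} → Tree d → ℕ → Set
T ∈C k = internal T ≡ k
  where open import Relation.Binary.PropositionalEquality using (_≡_)

mutual
  eqT : ∀ {d} → Tree d → Tree d → Bool
  eqT leaf      leaf      = true
  eqT leaf      (node _)  = false
  eqT (node _)  leaf      = false
  eqT (node ts) (node us) = eqV ts us

  eqV : ∀ {d n} → Vec (Tree d) n → Vec (Tree d) n → Bool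
  eqV []       []       = true
  eqV (t ∷ ts) (u ∷ us) = eqT t u ∧ eqV ts us

-- Vertex codes: words over {1,…,d}, here Fin d; the root is [] and the
-- children of u are u ++ [c]. Code length = height.

Code : ℕ → Set
Code d = List (Fin d)

subAt : ∀ {d} → Tree d → Code d → Maybe (Tree d)
subAt t        []      = just t
subAt leaf     (_ ∷ _) = nothing
subAt (node ts) (c ∷ u) = subAt (lookup ts c) u

hasCode : ∀ {d} → Tree d → Code d → Bool
hasCode t u = is-just (subAt t u)

replaceAt : ∀ {d} → Tree d → Code d → Tree d → Tree d
replaceAt t         []      s = s
replaceAt leaf      (_ ∷ _) s = leaf
replaceAt (node ts) (c ∷ u) s = node (updateAt ts c (λ t → replaceAt t u s))

fillAll : ∀ {d} → Tree d → List (Code d × Tree d) → Tree d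
fillAll t []             = t
fillAll t ((u , s) ∷ us) = fillAll (replaceAt t u s) us

zipL : ∀ {A B : Set} → List A → List B → List (A × B)
zipL []       _        = []
zipL (_ ∷ _)  []       = []
zipL (x ∷ xs) (y ∷ ys) = (x , y) ∷ zipL xs ys

-- For a vertex v (code of length j ≥ p), the ancestral path is
-- v_0 = take (j ∸ p) v, and v_i = v_{i-1} ++ [c_i] where c_1 … c_p
-- = drop (j ∸ p) v.  The sibling positions of v_1,…,v_p are
-- v_{i-1} ++ [c] with c ≠ c_i : (d-1)p positions in total.

siblingsAlong : ∀ {d} → Code d → Code d → List (Code d)
siblingsAlong pre []       = []
siblingsAlong {d} pre (c ∷ cs) =
  map (λ c' → pre ++ [ c' ]) (filterᵇ (λ c' → not ⌊ c' Fin.≟ c ⌋) (allFin d))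
  ++ siblingsAlong (pre ++ [ c ]) cs

sibPositions : ∀ {d} → Code d → ℕ → List (Code d)
sibPositions v p = siblingsAlong (take (length v ∸ p) v) (drop (length v ∸ p) v)

insertAll : ∀ {A : Set} → A → List A → List (List A)
insertAll x []       = [ x ∷ [] ]
insertAll x (y ∷ ys) = (x ∷ y ∷ ys) ∷ map (y ∷_) (insertAll x ys)

perms : ∀ {A : Set} → List A → List (List A)
perms []       = [ [] ]
perms (x ∷ xs) = concatMap (insertAll x) (perms xs)

-- Sh(T; v_0,…,v_p = v) as the (finite) list of its elements: all trees
-- obtained from T by rearranging the subtrees subtended by the sibling
-- positions among those positions.  (Meaningful when T contains v and
-- length v ≥ p.)
shClass : ∀ {d} → Tree d → Code d → ℕ → List (Tree d)
shClass t v p =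
  let P = sibPositions v p in
  map (λ ts → fillAll t (zipL P ts)) (perms (mapMaybe (subAt t) P))

memb : ∀ {d} → Tree d → List (Tree d) → Bool
memb t S = any (eqT t) S

sameSet : ∀ {d} → List (Tree d) → List (Tree d) → Bool
sameSet S S' = all (λ x → memb x S') S ∧ all (λ x → memb x S) S'

vecsOf : ∀ {A : Set} (n : ℕ) → List A → List (Vec A n)
vecsOf zero    xs = [ [] ]
vecsOf (suc n) xs = concatMap (λ x → map (x ∷_) (vecsOf n xs)) xs

treesH : (d h : ℕ) → List (Tree d)
treesH d zero    = [ leaf ]
treesH d (suc h) = leaf ∷ map node (vecsOf d (treesH d h))

-- all trees with k internal vertices (their height is ≤ k)
allC : (d k : ℕ) → List (Tree d)
allC d k = filterᵇ (λ t → ⌊ internal t ≟ k ⌋) (treesH d k)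

codes : (d j : ℕ) → List (Code d)
codes d zero    = [ [] ]
codes d (suc j) = concatMap (λ c → map (c ∷_) (codes d j)) (allFin d)

distinctClasses : (d p k : ℕ) → Code d → List (List (Tree d))
distinctClasses d p k v =
  deduplicateᵇ sameSet (map (λ t' → shClass t' v p) (filterᵇ (λ t' → hasCode t' v) (allC d k)))

innerSum : (d p k : ℕ) → Code d → Tree d → ℕ
innerSum d p k v T = length (filterᵇ (memb T) (distinctClasses d p k v))

-- Σ_{j ≥ p} Σ_{v ∈ [d]^j} Σ_S 1_S(T); vertices of trees in C_k have
-- height ≤ k, so all terms with j > p + k (indeed j > k) vanish.
totalSum : (d p k : ℕ) → Tree d → ℕ
totalSum d p k T =
  sum (map (λ i → sum (map (λ v → innerSum d p k v T) (codes d (p + i)))) (upTo (suc k)))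

ψ : (d p k : ℕ) → Tree d → ℚ
ψ d p k T = (+ totalSum d p k T / 1) ℚ.* (+ 1 / suc (d * k))

𝟙 : Bool → ℚ
𝟙 b = if b then 1ℚ else 0ℚ

sumℚ : List ℚ → ℚ
sumℚ = foldr ℚ._+_ 0ℚ

-- the data (T', v) describes a length-p shuffle class Sh(T'; v_0,…,v_p = v)
IsShuffleData : (d p k : ℕ) → Tree d → Code d → Set
IsShuffleData d p k t v = (t ∈C k) × (p ℕ.≤ length v) × (hasCode t v ≡ true)
  where open import Relation.Binary.PropositionalEquality using (_≡_)

InShuffleSpan : (d p k : ℕ) → (Tree d → ℚ) → Set
InShuffleSpan d p k f =
  Σ (List (ℚ × Tree d × Code d)) λ L →
    All (λ { (c , t , v) → IsShuffleData d p k t v }) L ×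
    (∀ T → T ∈C k →
       f T ≡ sumℚ (map (λ { (c , t , v) → c ℚ.* 𝟙 (memb T (shClass t v p)) }) L))
  where
    open import Data.Product using (Σ)
    open import Data.List.Relation.Unary.All using (All)
    open import Relation.Binary.PropositionalEquality using (_≡_)

-- C_{d,p} = (d^p − 1)/(d − 1)  (d ≥ 2; junk value 0 otherwise)
Cdp : ℕ → ℕ → ℚ
Cdp (suc (suc e)) p = + (suc (suc e) ^ p ∸ 1) / suc e
Cdp _             _ = 0ℚ

-- Fix a vertex code v of height at least p. A shuffle only permutes the subtrees hanging at the
-- sibling positions along the path to v; these positions are pairwise incomparable and incomparable
-- with v, so a shuffle keeps the vertex v, and two shuffle classes through v that share a tree
-- coincide. Hence the inner sum in ψ(T) is 1 when T has a vertex with code v and 0 otherwise, and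
-- (dk+1)ψ(T) is the number of vertices of T of height at least p. Of the dk+1 vertices of T at most
-- 1 + d + ⋯ + d^(p-1) = C_{d,p} have height less than p, which gives the bound; choosing one tree in
-- each distinct class writes ψ as a combination of class indicators with coefficients 1/(dk+1).

module Submission where

open import Defs

open import Data.Bool using (Bool; true; false; T; not)
open import Data.Bool.Properties using (T-∧; T-≡)
open import Data.Fin as Fin using (Fin)
open import Data.Integer as ℤ using (+_)
import Data.Integer.Properties as ℤ
import Data.Integer.Tactic.RingSolver as ℤ-Solver
open import Data.List
  using (List; []; _∷_; _++_; [_]; map; concatMap; filter; filterᵇ; allFin; tabulate; upTo;
         length; take; drop; mapMaybe; deduplicate; deduplicateᵇ)
open import Data.List.Properties
  using (++-assoc; take++drop≡id; map-++; map-∘; map-cong; map-tabulate; map-applyUpTo; length-map;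
         length-tabulate; filter-some; filter-none)
open import Data.List.Membership.Propositional using (_∈_; lose)
open import Data.List.Membership.Propositional.Properties
  using (∈-map⁺; ∈-map⁻; ∈-filter⁺; ∈-filter⁻; ∈-concat⁺′; ∈-concat⁻′; ∈-∃++;
         ∈-deduplicate⁻)
open import Data.List.Relation.Binary.Permutation.Propositional
  using (_↭_; ↭-refl; ↭-sym; ↭-trans; ↭-prep; ↭-swap)
open import Data.List.Relation.Binary.Permutation.Propositional.Properties
  using (↭-empty-inv; ∈-resp-↭; drop-mid; ↭-length)
open import Data.List.Relation.Binary.Subset.Propositional using (_⊆_)
open import Data.List.Relation.Unary.All as All using (All; []; _∷_)
import Data.List.Relation.Unary.All.Properties as All
open import Data.List.Relation.Unary.AllPairs as AllPairs using (AllPairs; []; _∷_)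
import Data.List.Relation.Unary.AllPairs.Properties as AllPairs
open import Data.List.Relation.Unary.Any as Any using (Any; here; there)
import Data.List.Relation.Unary.Any.Properties as Any
open import Data.Maybe using (just)
open import Data.Nat as ℕ using (ℕ; zero; suc; _+_; _*_; _^_; _∸_; _≤_; _<_; z≤n; s≤s; _≟_)
import Data.Nat.Properties as ℕ
open import Data.Nat.ListAction using (sum)
open import Data.Nat.ListAction.Properties using (sum-++)
open import Data.Nat.Tactic.RingSolver using (solve-∀)
open import Data.Product using (∃; _×_; _,_; proj₂)
open import Data.Rational as ℚ
  using (ℚ; _/_; 0ℚ; 1ℚ; ∣_∣; _-_) renaming (_≤_ to _≤ℚ_; _*_ to _*ℚ_)
import Data.Rational.Properties as ℚ
open import Data.Rational.Solver using (module +-*-Solver)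
open import Data.Rational.Unnormalised as ℚᵘ using (mkℚᵘ; _≃_; *≡*; *≤*)
import Data.Rational.Unnormalised.Properties as ℚᵘ
open import Data.Vec as Vec using (Vec; []; _∷_; lookup)
import Data.Vec.Properties as Vec
open import Function using (id; _∘_; _∘₂_; Equivalence)
open import Algebra.Properties.CommutativeSemigroup ℕ.+-commutativeSemigroup using (interchange)
import Relation.Binary.Definitions as Binary
open import Relation.Binary.PropositionalEquality hiding ([_])
open import Relation.Nullary using (¬_; yes; no; does)
open import Relation.Nullary.Decidable using (⌊_⌋; T?; ¬?; toWitness; fromWitness; toWitnessFalse)
open import Relation.Unary using (Decidable)

private
  variable
    A B : Set


∈-insertAll⁻ : ∀ (x : A) zs {ys} → ys ∈ insertAll x zs → ys ↭ x ∷ zs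
∈-insertAll⁻ x []       (here refl) = ↭-refl
∈-insertAll⁻ x (z ∷ zs) (here refl) = ↭-refl
∈-insertAll⁻ x (z ∷ zs) (there ys∈) with ys′ , ys′∈ , refl ← ∈-map⁻ (z ∷_) ys∈ =
  ↭-trans (↭-prep z (∈-insertAll⁻ x zs ys′∈)) (↭-swap z x ↭-refl)

∈-insertAll⁺ : ∀ (x : A) as bs → as ++ x ∷ bs ∈ insertAll x (as ++ bs)
∈-insertAll⁺ x []       []       = here refl
∈-insertAll⁺ x []       (b ∷ bs) = here refl
∈-insertAll⁺ x (a ∷ as) bs       = there (∈-map⁺ (a ∷_) (∈-insertAll⁺ x as bs))

∈-perms⁻ : ∀ (xs : List A) {ys} → ys ∈ perms xs → ys ↭ xs
∈-perms⁻ []       (here refl) = ↭-refl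
∈-perms⁻ (x ∷ xs) ys∈
  with zs , ys∈zs , zs∈ ← ∈-concat⁻′ (map (insertAll x) (perms xs)) ys∈
  with ws , ws∈ , refl ← ∈-map⁻ (insertAll x) zs∈ =
    ↭-trans (∈-insertAll⁻ x ws ys∈zs) (↭-prep x (∈-perms⁻ xs ws∈))

∈-perms⁺ : ∀ (xs : List A) {ys} → ys ↭ xs → ys ∈ perms xs
∈-perms⁺ []       ys↭ rewrite ↭-empty-inv ys↭ = here refl
∈-perms⁺ (x ∷ xs) ys↭ with as , bs , refl ← ∈-∃++ (∈-resp-↭ (↭-sym ys↭) (here refl)) =
  ∈-concat⁺′ (∈-insertAll⁺ x as bs) (∈-map⁺ (insertAll x) (∈-perms⁺ xs (drop-mid as [] ys↭)))

filter-map : ∀ {P : B → Set} (P? : Decidable P) (f : A → B) xs →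
             filter P? (map f xs) ≡ map f (filter (P? ∘ f) xs)
filter-map P? f []       = refl
filter-map P? f (x ∷ xs) with does (P? (f x))
... | true  = cong (f x ∷_) (filter-map P? f xs)
... | false = filter-map P? f xs

deduplicate-map : ∀ {R : B → B → Set} (R? : Binary.Decidable R) (f : A → B) xs →
                  deduplicate R? (map f xs) ≡ map f (deduplicate (λ x y → R? (f x) (f y)) xs)
deduplicate-map R? f []       = refl
deduplicate-map R? f (x ∷ xs) = cong (f x ∷_) (begin
  filter (¬? ∘ R? (f x)) (deduplicate R? (map f xs))
    ≡⟨ cong (filter (¬? ∘ R? (f x))) (deduplicate-map R? f xs) ⟩
  filter (¬? ∘ R? (f x)) (map f (deduplicate (λ x y → R? (f x) (f y)) xs))
    ≡⟨ filter-map (¬? ∘ R? (f x)) f (deduplicate (λ x y → R? (f x) (f y)) xs) ⟩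
  map f (filter (¬? ∘ R? (f x) ∘ f) (deduplicate (λ x y → R? (f x) (f y)) xs)) ∎)
  where open ≡-Reasoning

deduplicate-pairwise : ∀ {R : A → A → Set} (R? : Binary.Decidable R) xs →
                       AllPairs (λ x y → ¬ R x y) (deduplicate R? xs)
deduplicate-pairwise R? []       = []
deduplicate-pairwise R? (x ∷ xs) =
  All.all-filter (¬? ∘ R? x) (deduplicate R? xs) ∷
  AllPairs.filter⁺ (¬? ∘ R? x) (deduplicate-pairwise R? xs)

length-filter≤1 : ∀ {P : A → Set} {R : A → A → Set} (P? : Decidable P) {xs} →
                  AllPairs (λ x y → ¬ R x y) xs → (∀ {x y} → x ∈ xs → y ∈ xs → P x → P y → R x y) →
                  length (filter P? xs) ≤ 1
length-filter≤1 P? {[]}     _            _       = z≤n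
length-filter≤1 P? {x ∷ xs} (¬Rx ∷ ¬Rxs) related with P? x
... | yes px = s≤s (ℕ.≤-reflexive (cong length (filter-none P? (All.tabulate λ y∈ py →
                 All.lookup ¬Rx y∈ (related (here refl) (there y∈) px py)))))
... | no  _  = length-filter≤1 P? ¬Rxs (λ x∈ y∈ → related (there x∈) (there y∈))


indicator : Bool → ℕ
indicator true  = 1
indicator false = 0

sum-map-zero : ∀ (xs : List A) → sum (map (λ _ → 0) xs) ≡ 0
sum-map-zero []       = refl
sum-map-zero (_ ∷ xs) = sum-map-zero xs

sum-map-cong : ∀ {f g : A → ℕ} → (∀ x → f x ≡ g x) → ∀ xs → sum (map f xs) ≡ sum (map g xs)
sum-map-cong f≗g xs = cong sum (map-cong f≗g xs)

sum-map-mono : ∀ {f g : A → ℕ} → (∀ x → f x ≤ g x) → ∀ xs → sum (map f xs) ≤ sum (map g xs)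
sum-map-mono f≤g []       = z≤n
sum-map-mono f≤g (x ∷ xs) = ℕ.+-mono-≤ (f≤g x) (sum-map-mono f≤g xs)

sum-map-const : ∀ a (xs : List A) → sum (map (λ _ → a) xs) ≡ length xs * a
sum-map-const a []       = refl
sum-map-const a (_ ∷ xs) = cong (_+_ a) (sum-map-const a xs)

sum-map-+ : ∀ (f g : A → ℕ) xs → sum (map (λ x → f x + g x) xs) ≡ sum (map f xs) + sum (map g xs)
sum-map-+ f g []       = refl
sum-map-+ f g (x ∷ xs) rewrite sum-map-+ f g xs = interchange (f x) (g x) _ _

sum-map-*ˡ : ∀ a (f : A → ℕ) xs → sum (map (λ x → a * f x) xs) ≡ a * sum (map f xs)
sum-map-*ˡ a f []       = sym (ℕ.*-zeroʳ a)
sum-map-*ˡ a f (x ∷ xs) rewrite sum-map-*ˡ a f xs = sym (ℕ.*-distribˡ-+ a (f x) _)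

sum-map-comm : ∀ (f : A → B → ℕ) xs ys →
               sum (map (λ x → sum (map (f x) ys)) xs) ≡ sum (map (λ y → sum (map (λ x → f x y) xs)) ys)
sum-map-comm f []       ys = sym (sum-map-zero ys)
sum-map-comm f (x ∷ xs) ys rewrite sum-map-comm f xs ys = sym (sum-map-+ (f x) _ ys)

sum-map-concatMap : ∀ (g : B → ℕ) (h : A → List B) xs →
                    sum (map g (concatMap h xs)) ≡ sum (map (λ x → sum (map g (h x))) xs)
sum-map-concatMap g h []       = refl
sum-map-concatMap g h (x ∷ xs) rewrite map-++ g (h x) (concatMap h xs) =
  trans (sum-++ (map g (h x)) _) (cong (_+_ (sum (map g (h x)))) (sum-map-concatMap g h xs))

sum-upTo-suc : ∀ (f : ℕ → ℕ) n → sum (map f (upTo (suc n))) ≡ f 0 + sum (map (f ∘ suc) (upTo n))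
sum-upTo-suc f n =
  cong (λ xs → f 0 + sum xs) (trans (map-applyUpTo suc f n) (sym (map-applyUpTo id (f ∘ suc) n)))

sum-upTo-+ : ∀ (f : ℕ → ℕ) m n →
             sum (map f (upTo (m + n))) ≡ sum (map f (upTo m)) + sum (map (f ∘ _+_ m) (upTo n))
sum-upTo-+ f zero    n = refl
sum-upTo-+ f (suc m) n
  rewrite sum-upTo-suc f (m + n) | sum-upTo-+ (f ∘ suc) m n | sum-upTo-suc f m = sym (ℕ.+-assoc (f 0) _ _)

geometric-sum : ∀ e p → e * sum (map (suc e ^_) (upTo p)) + 1 ≡ suc e ^ p
geometric-sum e zero    = cong (_+ 1) (ℕ.*-zeroʳ e)
geometric-sum e (suc p) = begin
  e * sum (map (b ^_) (upTo (suc p))) + 1     ≡⟨ cong (λ s → e * s + 1) (sum-upTo-suc (b ^_) p) ⟩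
  e * (1 + sum (map (λ j → b * b ^ j) (upTo p))) + 1
    ≡⟨ cong (λ s → e * (1 + s) + 1) (sum-map-*ˡ b (b ^_) (upTo p)) ⟩
  e * (1 + b * G) + 1                         ≡⟨ factor e G ⟩
  b * (e * G + 1)                             ≡⟨ cong (b *_) (geometric-sum e p) ⟩
  b * b ^ p                                   ∎
  where
    open ≡-Reasoning
    b = suc e
    G = sum (map (b ^_) (upTo p))
    factor : ∀ e G → e * (1 + suc e * G) + 1 ≡ suc e * (e * G + 1)
    factor = solve-∀


toℚᵘ-/ : ∀ a b → ℚ.toℚᵘ (+ a / suc b) ≃ mkℚᵘ (+ a) b
toℚᵘ-/ a b = ℚ.toℚᵘ-fromℚᵘ (mkℚᵘ (+ a) b)

/1-+ : ∀ a b → + (a + b) / 1 ≡ + a / 1 ℚ.+ + b / 1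
/1-+ a b = ℚ.toℚᵘ-injective (begin
  ℚ.toℚᵘ (+ (a + b) / 1)                        ≈⟨ toℚᵘ-/ (a + b) 0 ⟩
  mkℚᵘ (+ (a + b)) 0                            ≈⟨ *≡* (cross-multiplied (+ a) (+ b)) ⟩
  mkℚᵘ (+ a) 0 ℚᵘ.+ mkℚᵘ (+ b) 0                ≈⟨ ℚᵘ.+-cong (toℚᵘ-/ a 0) (toℚᵘ-/ b 0) ⟨
  ℚ.toℚᵘ (+ a / 1) ℚᵘ.+ ℚ.toℚᵘ (+ b / 1)        ≈⟨ ℚ.toℚᵘ-homo-+ (+ a / 1) (+ b / 1) ⟨
  ℚ.toℚᵘ (+ a / 1 ℚ.+ + b / 1)                  ∎)
  where
    open ℚᵘ.≃-Reasoning
    cross-multiplied : ∀ x y → (x ℤ.+ y) ℤ.* + 1 ≡ (x ℤ.* + 1 ℤ.+ y ℤ.* + 1) ℤ.* + 1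
    cross-multiplied = ℤ-Solver.solve-∀

/1-*-1/ : ∀ m → + suc m / 1 ℚ.* (+ 1 / suc m) ≡ 1ℚ
/1-*-1/ m = ℚ.toℚᵘ-injective (begin
  ℚ.toℚᵘ (+ suc m / 1 ℚ.* (+ 1 / suc m))          ≈⟨ ℚ.toℚᵘ-homo-* (+ suc m / 1) (+ 1 / suc m) ⟩
  ℚ.toℚᵘ (+ suc m / 1) ℚᵘ.* ℚ.toℚᵘ (+ 1 / suc m)  ≈⟨ ℚᵘ.*-cong (toℚᵘ-/ (suc m) 0) (toℚᵘ-/ 1 m) ⟩
  mkℚᵘ (+ suc m) 0 ℚᵘ.* mkℚᵘ (+ 1) m              ≈⟨ *≡* cross-multiplied ⟩
  mkℚᵘ (+ 1) 0                                    ∎)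
  where
    open ℚᵘ.≃-Reasoning
    cancel : ∀ x → x ℤ.* + 1 ℤ.* + 1 ≡ + 1 ℤ.* x
    cancel = ℤ-Solver.solve-∀
    cross-multiplied : + suc m ℤ.* + 1 ℤ.* + 1 ≡ + 1 ℤ.* + (1 * suc m)
    cross-multiplied = trans (cancel (+ suc m)) (cong (λ n → + 1 ℤ.* + n) (sym (ℕ.*-identityˡ (suc m))))

/1-mono-≤ : ∀ {a b} → a ≤ b → + a / 1 ℚ.≤ + b / 1
/1-mono-≤ {a} {b} a≤b =
  ℚ.toℚᵘ-cancel-≤ (ℚᵘ.≤-respˡ-≃ (ℚᵘ.≃-sym (toℚᵘ-/ a 0)) (ℚᵘ.≤-respʳ-≃ (ℚᵘ.≃-sym (toℚᵘ-/ b 0))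
    (*≤* (subst₂ ℤ._≤_ (ℤ.pos-* a 1) (ℤ.pos-* b 1) (ℤ.+≤+ (ℕ.*-monoˡ-≤ 1 a≤b))))))

*-/-cancelˡ : ∀ e G → + (suc e * G) / suc e ≡ + G / 1
*-/-cancelˡ e G = ℚ.fromℚᵘ-cong {mkℚᵘ (+ (suc e * G)) e} {mkℚᵘ (+ G) 0} (*≡* (begin
  + (suc e * G) ℤ.* + 1     ≡⟨ cong (ℤ._* + 1) (ℤ.pos-* (suc e) G) ⟩
  + suc e ℤ.* + G ℤ.* + 1   ≡⟨ swap (+ suc e) (+ G) ⟩
  + G ℤ.* + suc e           ∎))
  where
    open ≡-Reasoning
    swap : ∀ x y → x ℤ.* y ℤ.* + 1 ≡ y ℤ.* x
    swap = ℤ-Solver.solve-∀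

deviation-bound : ∀ a b m G → a + b ≡ suc m → b ≤ G →
                  ∣ + a / 1 ℚ.* (+ 1 / suc m) - 1ℚ ∣ ℚ.≤ + G / 1 ℚ.* (+ 1 / suc m)
deviation-bound a b m G a+b≡ b≤G = begin
  ∣ qa ℚ.* r - 1ℚ ∣                   ≡⟨ cong (λ x → ∣ qa ℚ.* r - x ∣) (/1-*-1/ m) ⟨
  ∣ qa ℚ.* r - + suc m / 1 ℚ.* r ∣    ≡⟨ cong (λ x → ∣ qa ℚ.* r - x ℚ.* r ∣) sum≡ ⟩
  ∣ qa ℚ.* r - (qa ℚ.+ qb) ℚ.* r ∣    ≡⟨ cong ∣_∣ (cancel qa qb r) ⟩
  ∣ ℚ.- (qb ℚ.* r) ∣                  ≡⟨ ℚ.∣-p∣≡∣p∣ (qb ℚ.* r) ⟩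
  ∣ qb ℚ.* r ∣                        ≡⟨ ℚ.0≤p⇒∣p∣≡p 0≤qb*r ⟩
  qb ℚ.* r                            ≤⟨ ℚ.*-monoʳ-≤-nonNeg r (/1-mono-≤ b≤G) ⟩
  + G / 1 ℚ.* r                       ∎
  where
    open ℚ.≤-Reasoning
    qa = + a / 1
    qb = + b / 1
    r  = + 1 / suc m

    instance
      r≥0 : ℚ.NonNegative r
      r≥0 = ℚ.normalize-nonNeg 1 (suc m)

    sum≡ : + suc m / 1 ≡ qa ℚ.+ qb
    sum≡ = trans (cong (λ n → + n / 1) (sym a+b≡)) (/1-+ a b)

    0≤qb*r : 0ℚ ℚ.≤ qb ℚ.* r
    0≤qb*r = subst (ℚ._≤ qb ℚ.* r) (ℚ.*-zeroˡ r) (ℚ.*-monoʳ-≤-nonNeg r (/1-mono-≤ {b = b} z≤n))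

    cancel : ∀ x y z → x ℚ.* z - (x ℚ.+ y) ℚ.* z ≡ ℚ.- (y ℚ.* z)
    cancel = solve 3 (λ x y z → x :* z :+ :- ((x :+ y) :* z) := :- (y :* z)) refl
      where open +-*-Solver

sumℚ-++ : ∀ xs ys → sumℚ (xs ++ ys) ≡ sumℚ xs ℚ.+ sumℚ ys
sumℚ-++ []       ys = sym (ℚ.+-identityˡ _)
sumℚ-++ (x ∷ xs) ys rewrite sumℚ-++ xs ys = sym (ℚ.+-assoc x _ _)

sumℚ-map-cong : ∀ {f g : A → ℚ} → (∀ x → f x ≡ g x) → ∀ xs → sumℚ (map f xs) ≡ sumℚ (map g xs)
sumℚ-map-cong f≗g xs = cong sumℚ (map-cong f≗g xs)

sumℚ-map-concatMap : ∀ (g : B → ℚ) (h : A → List B) xs →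
                     sumℚ (map g (concatMap h xs)) ≡ sumℚ (map (λ x → sumℚ (map g (h x))) xs)
sumℚ-map-concatMap g h []       = refl
sumℚ-map-concatMap g h (x ∷ xs) rewrite map-++ g (h x) (concatMap h xs) =
  trans (sumℚ-++ (map g (h x)) _) (cong (sumℚ (map g (h x)) ℚ.+_) (sumℚ-map-concatMap g h xs))

sumℚ-map-/1 : ∀ c (f : A → ℕ) xs →
              sumℚ (map (λ x → + f x / 1 ℚ.* c) xs) ≡ + sum (map f xs) / 1 ℚ.* c
sumℚ-map-/1 c f []       = sym (ℚ.*-zeroˡ c)
sumℚ-map-/1 c f (x ∷ xs) = begin
  + f x / 1 ℚ.* c ℚ.+ sumℚ (map (λ x → + f x / 1 ℚ.* c) xs)
    ≡⟨ cong (+ f x / 1 ℚ.* c ℚ.+_) (sumℚ-map-/1 c f xs) ⟩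
  + f x / 1 ℚ.* c ℚ.+ + sum (map f xs) / 1 ℚ.* c
    ≡⟨ ℚ.*-distribʳ-+ c (+ f x / 1) _ ⟨
  (+ f x / 1 ℚ.+ + sum (map f xs) / 1) ℚ.* c
    ≡⟨ cong (ℚ._* c) (/1-+ (f x) _) ⟨
  + (f x + sum (map f xs)) / 1 ℚ.* c ∎
  where open ≡-Reasoning

𝟙-indicator : ∀ c b → c ℚ.* 𝟙 b ≡ + indicator b / 1 ℚ.* c
𝟙-indicator c true  = trans (ℚ.*-identityʳ c) (sym (ℚ.*-identityˡ c))
𝟙-indicator c false = trans (ℚ.*-zeroʳ c) (sym (ℚ.*-zeroˡ c))

sum-indicator : ∀ (b : A → Bool) xs → sum (map (indicator ∘ b) xs) ≡ length (filterᵇ b xs)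
sum-indicator b []       = refl
sum-indicator b (x ∷ xs) with b x
... | true  = cong suc (sum-indicator b xs)
... | false = sum-indicator b xs

sumℚ-𝟙 : ∀ c (b : A → Bool) xs →
         sumℚ (map (λ x → c ℚ.* 𝟙 (b x)) xs) ≡ + length (filterᵇ b xs) / 1 ℚ.* c
sumℚ-𝟙 c b xs = begin
  sumℚ (map (λ x → c ℚ.* 𝟙 (b x)) xs)                ≡⟨ sumℚ-map-cong (λ x → 𝟙-indicator c (b x)) xs ⟩
  sumℚ (map (λ x → + indicator (b x) / 1 ℚ.* c) xs)  ≡⟨ sumℚ-map-/1 c (indicator ∘ b) xs ⟩
  + sum (map (indicator ∘ b) xs) / 1 ℚ.* c           ≡⟨ cong (λ n → + n / 1 ℚ.* c) (sum-indicator b xs) ⟩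
  + length (filterᵇ b xs) / 1 ℚ.* c                  ∎
  where open ≡-Reasoning


-- Grafting subtrees at incomparable positions

module _ {d : ℕ} where

  data Incomparable : Code d → Code d → Set where
    fork    : ∀ {c c′ u w} → c ≢ c′ → Incomparable (c ∷ u) (c′ ∷ w)
    descend : ∀ {c u w} → Incomparable u w → Incomparable (c ∷ u) (c ∷ w)

  Incomparable-sym : ∀ {u w} → Incomparable u w → Incomparable w u
  Incomparable-sym (fork c≢c′) = fork (c≢c′ ∘ sym)
  Incomparable-sym (descend i) = descend (Incomparable-sym i)

  Incomparable-++ : ∀ (pre : Code d) {u w} → Incomparable u w → Incomparable (pre ++ u) (pre ++ w)
  Incomparable-++ []        i = i
  Incomparable-++ (c ∷ pre) i = descend (Incomparable-++ pre i)

  HasVertex : Tree d → Code d → Set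
  HasVertex t u = ∃ λ s → subAt t u ≡ just s

  subAt-replaceAt : ∀ t u {s} → HasVertex t u → subAt (replaceAt t u s) u ≡ just s
  subAt-replaceAt t         []      _ = refl
  subAt-replaceAt (node ts) (c ∷ u) {s} h
    rewrite Vec.lookup∘updateAt c {λ t → replaceAt t u s} ts = subAt-replaceAt (lookup ts c) u h

  subAt-replaceAt-incomparable : ∀ t {u w s} → Incomparable u w →
                                 subAt (replaceAt t u s) w ≡ subAt t w
  subAt-replaceAt-incomparable leaf      (fork _)    = refl
  subAt-replaceAt-incomparable leaf      (descend _) = refl
  subAt-replaceAt-incomparable (node ts) {c ∷ u} {c′ ∷ w} {s} (fork c≢c′)
    rewrite Vec.lookup∘updateAt′ c′ c {λ t → replaceAt t u s} (c≢c′ ∘ sym) ts = refl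
  subAt-replaceAt-incomparable (node ts) {c ∷ u} {_ ∷ w} {s} (descend i)
    rewrite Vec.lookup∘updateAt c {λ t → replaceAt t u s} ts = subAt-replaceAt-incomparable (lookup ts c) i

  HasVertex-replaceAt : ∀ t {u w s} → Incomparable u w → HasVertex t w → HasVertex (replaceAt t u s) w
  HasVertex-replaceAt t i (s′ , eq) = s′ , trans (subAt-replaceAt-incomparable t i) eq

  replaceAt-idem : ∀ (t : Tree d) u s s′ → replaceAt (replaceAt t u s) u s′ ≡ replaceAt t u s′
  replaceAt-idem t         []      s s′ = refl
  replaceAt-idem leaf      (c ∷ u) s s′ = refl
  replaceAt-idem (node ts) (c ∷ u) s s′ =
    cong node (trans (Vec.updateAt-updateAt c ts) (Vec.updateAt-cong c (λ t → replaceAt-idem t u s s′) ts))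

  replaceAt-comm : ∀ (t : Tree d) {u w} s s′ → Incomparable u w →
                   replaceAt (replaceAt t u s) w s′ ≡ replaceAt (replaceAt t w s′) u s
  replaceAt-comm leaf      s s′ (fork _)    = refl
  replaceAt-comm leaf      s s′ (descend _) = refl
  replaceAt-comm (node ts) {c ∷ _} {c′ ∷ _} s s′ (fork c≢c′) =
    cong node (Vec.updateAt-commutes c′ c (c≢c′ ∘ sym) ts)
  replaceAt-comm (node ts) {c ∷ _} s s′ (descend i) =
    cong node (trans (Vec.updateAt-updateAt c ts)
              (trans (Vec.updateAt-cong c (λ t → replaceAt-comm t s s′ i) ts)
                     (sym (Vec.updateAt-updateAt c ts))))

  replaceAt-subAt : ∀ (t : Tree d) u {s} → subAt t u ≡ just s → replaceAt t u s ≡ t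
  replaceAt-subAt t         []      refl = refl
  replaceAt-subAt (node ts) (c ∷ u) eq   =
    cong node (Vec.updateAt-id-local c ts (replaceAt-subAt (lookup ts c) u eq))

  graft : Tree d → List (Code d) → List (Tree d) → Tree d
  graft t P ss = fillAll t (zipL P ss)

  subtreesAt : Tree d → List (Code d) → List (Tree d)
  subtreesAt t P = mapMaybe (subAt t) P

  subAt-graft : ∀ t P ss {w} → All (Incomparable w) P → subAt (graft t P ss) w ≡ subAt t w
  subAt-graft t []      ss       []       = refl
  subAt-graft t (u ∷ P) []       _        = refl
  subAt-graft t (u ∷ P) (s ∷ ss) (i ∷ is) =
    trans (subAt-graft (replaceAt t u s) P ss is) (subAt-replaceAt-incomparable t (Incomparable-sym i))

  replaceAt-graft : ∀ t P ss {u s} → All (Incomparable u) P →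
                    replaceAt (graft t P ss) u s ≡ graft (replaceAt t u s) P ss
  replaceAt-graft t []      ss        []       = refl
  replaceAt-graft t (w ∷ P) []        _        = refl
  replaceAt-graft t (w ∷ P) (s′ ∷ ss) {u} {s} (i ∷ is) =
    trans (replaceAt-graft (replaceAt t w s′) P ss is)
          (cong (λ t′ → graft t′ P ss) (sym (replaceAt-comm t s s′ i)))

  subtreesAt-graft : ∀ t P ss → AllPairs Incomparable P → All (HasVertex t) P →
                     length ss ≡ length P → subtreesAt (graft t P ss) P ≡ ss
  subtreesAt-graft t []      []       _        _        _  = refl
  subtreesAt-graft t (u ∷ P) (s ∷ ss) (i ∷ is) (h ∷ hs) eq
    rewrite subAt-graft (replaceAt t u s) P ss {u} i | subAt-replaceAt t u {s} h =
      cong (s ∷_) (subtreesAt-graft (replaceAt t u s) P ss is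
                     (All.zipWith (λ (j , h′) → HasVertex-replaceAt t j h′) (i , hs)) (ℕ.suc-injective eq))

  graft-graft : ∀ t P ss ss′ → AllPairs Incomparable P → length ss ≡ length ss′ →
                graft (graft t P ss) P ss′ ≡ graft t P ss′
  graft-graft t []      ss       ss′        _        _  = refl
  graft-graft t (u ∷ P) []       []         _        _  = refl
  graft-graft t (u ∷ P) (s ∷ ss) (s′ ∷ ss′) (i ∷ is) eq = begin
    graft (replaceAt (graft (replaceAt t u s) P ss) u s′) P ss′
      ≡⟨ cong (λ t′ → graft t′ P ss′) (replaceAt-graft (replaceAt t u s) P ss i) ⟩
    graft (graft (replaceAt (replaceAt t u s) u s′) P ss) P ss′
      ≡⟨ cong (λ t′ → graft (graft t′ P ss) P ss′) (replaceAt-idem t u s s′) ⟩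
    graft (graft (replaceAt t u s′) P ss) P ss′
      ≡⟨ graft-graft (replaceAt t u s′) P ss ss′ is (ℕ.suc-injective eq) ⟩
    graft (replaceAt t u s′) P ss′ ∎
    where open ≡-Reasoning

  graft-subtreesAt : ∀ t P → All (HasVertex t) P → graft t P (subtreesAt t P) ≡ t
  graft-subtreesAt t []      []             = refl
  graft-subtreesAt t (u ∷ P) ((s , eq) ∷ hs)
    rewrite eq | replaceAt-subAt t u eq = graft-subtreesAt t P hs

  length-subtreesAt : ∀ t P → All (HasVertex t) P → length (subtreesAt t P) ≡ length P
  length-subtreesAt t []      []             = refl
  length-subtreesAt t (u ∷ P) ((s , eq) ∷ hs) rewrite eq = cong suc (length-subtreesAt t P hs)


module _ {d : ℕ} where

  siblings : Code d → Fin d → List (Code d)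
  siblings pre c = map (λ c′ → pre ++ [ c′ ]) (filterᵇ (λ c′ → not ⌊ c′ Fin.≟ c ⌋) (allFin d))

  ∈-siblings⁻ : ∀ {pre c w} → w ∈ siblings pre c → ∃ λ c′ → c′ ≢ c × w ≡ pre ++ [ c′ ]
  ∈-siblings⁻ {pre} {c} w∈ with c′ , c′∈ , refl ← ∈-map⁻ (λ c′ → pre ++ [ c′ ]) w∈ =
    c′ , toWitnessFalse (proj₂ (∈-filter⁻ (λ c′ → T? (not ⌊ c′ Fin.≟ c ⌋)) {xs = allFin d} c′∈)) ,
    refl

  siblings-pairwise : ∀ pre c → AllPairs Incomparable (siblings pre c)
  siblings-pairwise pre c =
    AllPairs.map⁺ (AllPairs.filter⁺ _ (AllPairs.tabulate⁺ (Incomparable-++ pre ∘ fork)))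

  siblingsAlong-extends : ∀ pre cs → All (λ w → ∃ λ x → w ≡ pre ++ x) (siblingsAlong pre cs)
  siblingsAlong-extends pre []       = []
  siblingsAlong-extends pre (c ∷ cs) =
    All.++⁺ (All.tabulate λ w∈ → let c′ , _ , eq = ∈-siblings⁻ w∈ in [ c′ ] , eq)
            (All.map (λ { (x , refl) → c ∷ x , ++-assoc pre [ c ] x })
                     (siblingsAlong-extends (pre ++ [ c ]) cs))

  siblingsAlong-pairwise : ∀ pre cs → AllPairs Incomparable (siblingsAlong pre cs)
  siblingsAlong-pairwise pre []       = []
  siblingsAlong-pairwise pre (c ∷ cs) =
    AllPairs.++⁺ (siblings-pairwise pre c) (siblingsAlong-pairwise (pre ++ [ c ]) cs)
      (All.tabulate λ w∈ → All.map (across (∈-siblings⁻ w∈)) (siblingsAlong-extends (pre ++ [ c ]) cs))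
    where
      across : ∀ {w z} → (∃ λ c′ → c′ ≢ c × w ≡ pre ++ [ c′ ]) →
               (∃ λ x → z ≡ (pre ++ [ c ]) ++ x) → Incomparable w z
      across (c′ , c′≢c , refl) (x , refl) rewrite ++-assoc pre [ c ] x = Incomparable-++ pre (fork c′≢c)

  siblingsAlong-incomparable : ∀ pre cs → All (Incomparable (pre ++ cs)) (siblingsAlong pre cs)
  siblingsAlong-incomparable pre []       = []
  siblingsAlong-incomparable pre (c ∷ cs) =
    All.++⁺ (All.tabulate λ w∈ → let c′ , c′≢c , eq = ∈-siblings⁻ w∈ in
               subst (Incomparable _) (sym eq) (Incomparable-++ pre (fork (c′≢c ∘ sym))))
            (subst (λ u → All (Incomparable u) (siblingsAlong (pre ++ [ c ]) cs)) (++-assoc pre [ c ] cs)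
                   (siblingsAlong-incomparable (pre ++ [ c ]) cs))

  HasVertex-sibling : ∀ (t : Tree d) pre {c cs} c′ →
                      HasVertex t (pre ++ c ∷ cs) → HasVertex t (pre ++ [ c′ ])
  HasVertex-sibling leaf      []        c′ (_ , ())
  HasVertex-sibling leaf      (x ∷ pre) c′ (_ , ())
  HasVertex-sibling (node ts) []        c′ _ = lookup ts c′ , refl
  HasVertex-sibling (node ts) (x ∷ pre) c′ h = HasVertex-sibling (lookup ts x) pre c′ h

  siblingsAlong-vertices : ∀ (t : Tree d) pre cs →
                           HasVertex t (pre ++ cs) → All (HasVertex t) (siblingsAlong pre cs)
  siblingsAlong-vertices t pre []       h = []
  siblingsAlong-vertices t pre (c ∷ cs) h =
    All.++⁺ (All.tabulate λ w∈ → let c′ , _ , eq = ∈-siblings⁻ w∈ in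
               subst (HasVertex t) (sym eq) (HasVertex-sibling t pre c′ h))
            (siblingsAlong-vertices t (pre ++ [ c ]) cs (subst (HasVertex t) (sym (++-assoc pre [ c ] cs)) h))

  module _ (v : Code d) (p : ℕ) where

    private
      j = length v ∸ p

    sibPositions-pairwise : AllPairs Incomparable (sibPositions v p)
    sibPositions-pairwise = siblingsAlong-pairwise (take j v) (drop j v)

    sibPositions-incomparable : All (Incomparable v) (sibPositions v p)
    sibPositions-incomparable = subst (λ u → All (Incomparable u) (sibPositions v p)) (take++drop≡id j v)
                                      (siblingsAlong-incomparable (take j v) (drop j v))

    sibPositions-vertices : ∀ t → HasVertex t v → All (HasVertex t) (sibPositions v p)
    sibPositions-vertices t h =
      siblingsAlong-vertices t (take j v) (drop j v) (subst (HasVertex t) (sym (take++drop≡id j v)) h)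


-- Shuffle classes

module _ {d : ℕ} {v : Code d} {p : ℕ} where

  private
    P = sibPositions v p

    length-shuffled : ∀ {t ss} → HasVertex t v → ss ↭ subtreesAt t P → length ss ≡ length P
    length-shuffled {t} h ss↭ = trans (↭-length ss↭) (length-subtreesAt t P (sibPositions-vertices v p t h))

  ∈-shClass⁻ : ∀ {t x} → x ∈ shClass t v p → ∃ λ ss → ss ↭ subtreesAt t P × x ≡ graft t P ss
  ∈-shClass⁻ {t} x∈ with ss , ss∈ , refl ← ∈-map⁻ (graft t P) x∈ = ss , ∈-perms⁻ _ ss∈ , refl

  ∈-shClass⁺ : ∀ {t ss} → ss ↭ subtreesAt t P → graft t P ss ∈ shClass t v p
  ∈-shClass⁺ {t} ss↭ = ∈-map⁺ (graft t P) (∈-perms⁺ _ ss↭)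

  shClass-∋ : ∀ {t} → HasVertex t v → t ∈ shClass t v p
  shClass-∋ {t} h = subst (_∈ shClass t v p) (graft-subtreesAt t P (sibPositions-vertices v p t h))
                          (∈-shClass⁺ ↭-refl)

  HasVertex-shClass : ∀ {t x} → x ∈ shClass t v p → HasVertex t v → HasVertex x v
  HasVertex-shClass {t} x∈ (s , eq) with ss , _ , refl ← ∈-shClass⁻ x∈ =
    s , trans (subAt-graft t P ss (sibPositions-incomparable v p)) eq

  -- The common tree determines the shuffled subtrees, and grafting onto it is grafting onto t₁ or t₂.
  graft-∈-shClass : ∀ {t₁ t₂ ss₁ ss₂ ss} → HasVertex t₁ v → HasVertex t₂ v →
                    ss₁ ↭ subtreesAt t₁ P → ss₂ ↭ subtreesAt t₂ P → ss ↭ subtreesAt t₁ P →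
                    graft t₁ P ss₁ ≡ graft t₂ P ss₂ → graft t₁ P ss ∈ shClass t₂ v p
  graft-∈-shClass {t₁} {t₂} {ss₁} {ss₂} {ss} h₁ h₂ ss₁↭ ss₂↭ ss↭ same =
    subst (_∈ shClass t₂ v p) (sym same-graft)
          (∈-shClass⁺ (↭-trans ss↭ (↭-trans (↭-sym ss₁↭) (subst (_↭ _) (sym same-subtrees) ss₂↭))))
    where
      open ≡-Reasoning
      pairwise = sibPositions-pairwise v p
      vertices : ∀ {t} → HasVertex t v → All (HasVertex t) P
      vertices = sibPositions-vertices v p _
      ∣ss₁∣ = length-shuffled h₁ ss₁↭
      ∣ss₂∣ = length-shuffled h₂ ss₂↭
      ∣ss∣  = length-shuffled h₁ ss↭

      same-subtrees : ss₁ ≡ ss₂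
      same-subtrees = begin
        ss₁                            ≡⟨ subtreesAt-graft t₁ P ss₁ pairwise (vertices h₁) ∣ss₁∣ ⟨
        subtreesAt (graft t₁ P ss₁) P  ≡⟨ cong (λ x → subtreesAt x P) same ⟩
        subtreesAt (graft t₂ P ss₂) P  ≡⟨ subtreesAt-graft t₂ P ss₂ pairwise (vertices h₂) ∣ss₂∣ ⟩
        ss₂                            ∎

      same-graft : graft t₁ P ss ≡ graft t₂ P ss
      same-graft = begin
        graft t₁ P ss                ≡⟨ graft-graft t₁ P ss₁ ss pairwise (trans ∣ss₁∣ (sym ∣ss∣)) ⟨
        graft (graft t₁ P ss₁) P ss  ≡⟨ cong (λ x → graft x P ss) same ⟩
        graft (graft t₂ P ss₂) P ss  ≡⟨ graft-graft t₂ P ss₂ ss pairwise (trans ∣ss₂∣ (sym ∣ss∣)) ⟩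
        graft t₂ P ss                ∎

  shClass-⊆ : ∀ {t₁ t₂ x} → HasVertex t₁ v → HasVertex t₂ v →
              x ∈ shClass t₁ v p → x ∈ shClass t₂ v p → shClass t₁ v p ⊆ shClass t₂ v p
  shClass-⊆ h₁ h₂ x∈₁ x∈₂ y∈
    with ss₁ , ss₁↭ , refl ← ∈-shClass⁻ x∈₁
    with ss₂ , ss₂↭ , same ← ∈-shClass⁻ x∈₂
    with ss , ss↭ , refl ← ∈-shClass⁻ y∈ = graft-∈-shClass h₁ h₂ ss₁↭ ss₂↭ ss↭ same


module _ {d : ℕ} where

  hasCode⁺ : ∀ (t : Tree d) u → HasVertex t u → T (hasCode t u)
  hasCode⁺ t u (_ , eq) rewrite eq = _

  hasCode⁻ : ∀ (t : Tree d) u → T (hasCode t u) → HasVertex t u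
  hasCode⁻ t u h with subAt t u
  ... | just s = s , refl

  mutual
    eqT-refl : (t : Tree d) → T (eqT t t)
    eqT-refl leaf      = _
    eqT-refl (node ts) = eqV-refl ts

    eqV-refl : ∀ {n} (ts : Vec (Tree d) n) → T (eqV ts ts)
    eqV-refl []       = _
    eqV-refl (t ∷ ts) = Equivalence.from T-∧ (eqT-refl t , eqV-refl ts)

  mutual
    eqT-sound : (t u : Tree d) → T (eqT t u) → t ≡ u
    eqT-sound leaf      leaf      _  = refl
    eqT-sound leaf      (node _)  ()
    eqT-sound (node _)  leaf      ()
    eqT-sound (node ts) (node us) eq = cong node (eqV-sound ts us eq)

    eqV-sound : ∀ {n} (ts us : Vec (Tree d) n) → T (eqV ts us) → ts ≡ us
    eqV-sound []       []       _  = refl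
    eqV-sound (t ∷ ts) (u ∷ us) eq =
      let eq₁ , eq₂ = Equivalence.to T-∧ eq in cong₂ _∷_ (eqT-sound t u eq₁) (eqV-sound ts us eq₂)

  memb⁺ : ∀ {t : Tree d} {S} → t ∈ S → T (memb t S)
  memb⁺ {t} t∈ = Any.any⁺ (eqT t) (Any.map (λ { refl → eqT-refl t }) t∈)

  memb⁻ : ∀ (t : Tree d) S → T (memb t S) → t ∈ S
  memb⁻ t S m = Any.map (eqT-sound t _) (Any.any⁻ (eqT t) S m)

  sameSet⁺ : ∀ {S S′ : List (Tree d)} → S ⊆ S′ → S′ ⊆ S → T (sameSet S S′)
  sameSet⁺ S⊆S′ S′⊆S = Equivalence.from T-∧
    (All.all⁻ _ (All.tabulate (memb⁺ ∘ S⊆S′)) , All.all⁻ _ (All.tabulate (memb⁺ ∘ S′⊆S)))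

  sameSet⁻ : ∀ (S S′ : List (Tree d)) → T (sameSet S S′) → S ⊆ S′ × S′ ⊆ S
  sameSet⁻ S S′ same = let same₁ , same₂ = Equivalence.to T-∧ same in
    (λ x∈ → memb⁻ _ S′ (All.lookup (All.all⁺ _ S same₁) x∈)) ,
    (λ x∈ → memb⁻ _ S (All.lookup (All.all⁺ _ S′ same₂) x∈))


vecsOf-complete : ∀ n (xs : List A) (ts : Vec A n) → (∀ i → lookup ts i ∈ xs) → ts ∈ vecsOf n xs
vecsOf-complete zero    xs []       _    = here refl
vecsOf-complete (suc n) xs (t ∷ ts) ts⊆xs =
  ∈-concat⁺′ (∈-map⁺ (t ∷_) (vecsOf-complete n xs ts (ts⊆xs ∘ Fin.suc)))
             (∈-map⁺ (λ x → map (x ∷_) (vecsOf n xs)) (ts⊆xs Fin.zero))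

module _ {d : ℕ} where

  internal-lookup≤ : ∀ {n} (ts : Vec (Tree d) n) i → internal (lookup ts i) ≤ internalV ts
  internal-lookup≤ (t ∷ ts) Fin.zero    = ℕ.m≤m+n _ _
  internal-lookup≤ (t ∷ ts) (Fin.suc i) = ℕ.≤-trans (internal-lookup≤ ts i) (ℕ.m≤n+m _ _)

  ∈-treesH : ∀ h (t : Tree d) → internal t ≤ h → t ∈ treesH d h
  ∈-treesH zero    leaf      _         = here refl
  ∈-treesH (suc h) leaf      _         = here refl
  ∈-treesH (suc h) (node ts) (s≤s ≤h) = there (∈-map⁺ node (vecsOf-complete d (treesH d h) ts
    (λ i → ∈-treesH h (lookup ts i) (ℕ.≤-trans (internal-lookup≤ ts i) ≤h))))

  ∈-allC⁺ : ∀ {k} {t : Tree d} → t ∈C k → t ∈ allC d k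
  ∈-allC⁺ {k} {t} refl =
    ∈-filter⁺ (λ t → T? ⌊ internal t ≟ k ⌋) (∈-treesH k t ℕ.≤-refl) (fromWitness refl)

  ∈-allC⁻ : ∀ {k} {t : Tree d} → t ∈ allC d k → t ∈C k
  ∈-allC⁻ {k} t∈ = toWitness (proj₂ (∈-filter⁻ (λ t → T? ⌊ internal t ≟ k ⌋) {xs = treesH d k} t∈))

  length-∈-codes : ∀ j {v : Code d} → v ∈ codes d j → length v ≡ j
  length-∈-codes zero    (here refl) = refl
  length-∈-codes (suc j) v∈
    with vs , v∈vs , vs∈ ← ∈-concat⁻′ (map (λ c → map (c ∷_) (codes d j)) (allFin d)) v∈
    with c , _ , refl ← ∈-map⁻ (λ c → map (c ∷_) (codes d j)) vs∈
    with u , u∈ , refl ← ∈-map⁻ (c ∷_) v∈vs = cong suc (length-∈-codes j u∈)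


-- Counting the distinct classes through a vertex

module _ {d : ℕ} (p k : ℕ) (v : Code d) where

  private
    candidates : List (Tree d)
    candidates = filterᵇ (λ t → hasCode t v) (allC d k)

    ∈-distinctClasses⁻ : ∀ {S} → S ∈ distinctClasses d p k v → ∃ λ t → HasVertex t v × S ≡ shClass t v p
    ∈-distinctClasses⁻ S∈ with t , t∈ , refl ← ∈-map⁻ (λ t → shClass t v p) (∈-deduplicate⁻ _ _ S∈) =
      t , hasCode⁻ t v (proj₂ (∈-filter⁻ (λ t → T? (hasCode t v)) {xs = allC d k} t∈)) , refl

  innerSum≤1 : ∀ t → innerSum d p k v t ≤ 1
  innerSum≤1 t = length-filter≤1 (T? ∘ memb t) (deduplicate-pairwise _ _) related
    where
      related : ∀ {S S′} → S ∈ distinctClasses d p k v → S′ ∈ distinctClasses d p k v →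
                T (memb t S) → T (memb t S′) → T (sameSet S S′)
      related {S} {S′} S∈ S′∈ t∈S t∈S′
        with _ , h , refl ← ∈-distinctClasses⁻ S∈ | _ , h′ , refl ← ∈-distinctClasses⁻ S′∈ =
          sameSet⁺ (shClass-⊆ {v = v} {p = p} h h′ t∈₁ t∈₂)
                   (shClass-⊆ {v = v} {p = p} h′ h t∈₂ t∈₁)
        where t∈₁ = memb⁻ t S t∈S
              t∈₂ = memb⁻ t S′ t∈S′

  1≤innerSum : ∀ {t} → t ∈C k → HasVertex t v → 1 ≤ innerSum d p k v t
  1≤innerSum {t} t∈C h = filter-some (T? ∘ memb t) own-distinct-class
    where
      sameSet⇒⊇ : ∀ {S S′} → T (sameSet S′ S) → T (memb t S) → T (memb t S′)
      sameSet⇒⊇ {S} {S′} same = memb⁺ ∘ proj₂ (sameSet⁻ S′ S same) ∘ memb⁻ t S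

      own-class : Any (T ∘ memb t) (map (λ t′ → shClass t′ v p) candidates)
      own-class = Any.map⁺ (lose (∈-filter⁺ (λ t → T? (hasCode t v)) (∈-allC⁺ t∈C) (hasCode⁺ t v h))
                                 (memb⁺ (shClass-∋ {v = v} {p = p} h)))

      own-distinct-class : Any (T ∘ memb t) (distinctClasses d p k v)
      own-distinct-class = Any.deduplicate⁺ _ (λ {S} {S′} → sameSet⇒⊇ {S} {S′}) own-class

  innerSum≡0 : ∀ {t} → ¬ HasVertex t v → innerSum d p k v t ≡ 0
  innerSum≡0 {t} ¬h = cong length (filter-none (T? ∘ memb t) (All.tabulate no-class))
    where
      no-class : ∀ {S} → S ∈ distinctClasses d p k v → ¬ T (memb t S)
      no-class S∈ t∈S with t′ , h , refl ← ∈-distinctClasses⁻ S∈ =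
        ¬h (HasVertex-shClass {v = v} {p = p} (memb⁻ t (shClass t′ v p) t∈S) h)

  innerSum-indicator : ∀ {t} → t ∈C k → innerSum d p k v t ≡ indicator (hasCode t v)
  innerSum-indicator {t} t∈C with hasCode t v in eq
  ... | true  = ℕ.≤-antisym (innerSum≤1 t)
                            (1≤innerSum t∈C (hasCode⁻ t v (subst T (sym eq) _)))
  ... | false = innerSum≡0 (λ h → subst T eq (hasCode⁺ t v h))


-- Vertex counts by height

module _ {d : ℕ} where

  verticesAt : ℕ → Tree d → ℕ
  verticesAt j t = sum (map (indicator ∘ hasCode t) (codes d j))

  verticesAt-suc : ∀ j t → verticesAt (suc j) t ≡
                   sum (map (λ c → sum (map (λ u → indicator (hasCode t (c ∷ u))) (codes d j))) (allFin d))
  verticesAt-suc j t = trans (sum-map-concatMap _ (λ c → map (c ∷_) (codes d j)) (allFin d))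
    (sum-map-cong (λ c → cong sum (sym (map-∘ (codes d j)))) (allFin d))

  verticesAt-leaf : ∀ j → verticesAt (suc j) leaf ≡ 0
  verticesAt-leaf j = trans (verticesAt-suc j leaf)
    (trans (sum-map-cong (λ _ → sum-map-zero (codes d j)) (allFin d)) (sum-map-zero (allFin d)))

  verticesAt≤ : ∀ j t → verticesAt j t ≤ d ^ j
  verticesAt≤ zero    t         = ℕ.≤-refl
  verticesAt≤ (suc j) leaf      = subst (_≤ d ^ suc j) (sym (verticesAt-leaf j)) z≤n
  verticesAt≤ (suc j) (node ts) = begin
    verticesAt (suc j) (node ts)                             ≡⟨ verticesAt-suc j (node ts) ⟩
    sum (map (λ c → verticesAt j (lookup ts c)) (allFin d))  ≤⟨ sum-map-mono (λ c → verticesAt≤ j _) (allFin d) ⟩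
    sum (map (λ _ → d ^ j) (allFin d))                       ≡⟨ sum-map-const (d ^ j) (allFin d) ⟩
    length (allFin d) * d ^ j                                ≡⟨ cong (_* d ^ j) (length-tabulate {n = d} id) ⟩
    d * d ^ j                                                ∎
    where open ℕ.≤-Reasoning

  sum-lookup-internal : ∀ {n} (ts : Vec (Tree d) n) →
                        sum (map (internal ∘ lookup ts) (allFin n)) ≡ internalV ts
  sum-lookup-internal {n} ts = trans (cong sum (map-tabulate id (internal ∘ lookup ts))) (go ts)
    where
      go : ∀ {n} (ts : Vec (Tree d) n) → sum (tabulate (internal ∘ lookup ts)) ≡ internalV ts
      go []       = refl
      go (t ∷ ts) = cong (_+_ (internal t)) (go ts)

  vertexCount : ∀ H t → internal t < H →
                sum (map (λ j → verticesAt j t) (upTo H)) ≡ suc (d * internal t)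
  vertexCount (suc H) t internal<H =
    trans (sum-upTo-suc (λ j → verticesAt j t) H) (cong suc (count-below t internal<H))
    where
      open ≡-Reasoning
      count-below : ∀ t → internal t < suc H →
                    sum (map (λ j → verticesAt (suc j) t) (upTo H)) ≡ d * internal t
      count-below leaf _ = begin
        sum (map (λ j → verticesAt (suc j) leaf) (upTo H))     ≡⟨ sum-map-cong verticesAt-leaf (upTo H) ⟩
        sum (map (λ _ → 0) (upTo H))                          ≡⟨ sum-map-zero (upTo H) ⟩
        0                                                     ≡⟨ ℕ.*-zeroʳ d ⟨
        d * 0                                                 ∎
      count-below (node ts) (s≤s internal<H) = begin
        sum (map (λ j → verticesAt (suc j) (node ts)) (upTo H))
          ≡⟨ sum-map-cong (λ j → verticesAt-suc j (node ts)) (upTo H) ⟩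
        sum (map (λ j → sum (map (λ c → verticesAt j (lookup ts c)) (allFin d))) (upTo H))
          ≡⟨ sum-map-comm (λ j c → verticesAt j (lookup ts c)) (upTo H) (allFin d) ⟩
        sum (map (λ c → sum (map (λ j → verticesAt j (lookup ts c)) (upTo H))) (allFin d))
          ≡⟨ sum-map-cong (λ c → vertexCount H (lookup ts c)
                 (ℕ.<-≤-trans (s≤s (internal-lookup≤ ts c)) internal<H)) (allFin d) ⟩
        sum (map (λ c → 1 + d * internal (lookup ts c)) (allFin d))
          ≡⟨ sum-map-+ (λ _ → 1) (λ c → d * internal (lookup ts c)) (allFin d) ⟩
        sum (map (λ _ → 1) (allFin d)) + sum (map (λ c → d * internal (lookup ts c)) (allFin d))
          ≡⟨ cong₂ _+_ (trans (sum-map-const 1 (allFin d)) (trans (ℕ.*-identityʳ _) (length-tabulate id)))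
                       (trans (sum-map-*ˡ d (internal ∘ lookup ts) (allFin d))
                              (cong (d *_) (sum-lookup-internal ts))) ⟩
        d + d * internalV ts
          ≡⟨ ℕ.*-suc d (internalV ts) ⟨
        d * suc (internalV ts) ∎


Cdp-geometric : ∀ e p → Cdp (suc (suc e)) p ≡ + sum (map (suc (suc e) ^_) (upTo p)) / 1
Cdp-geometric e p = trans (cong (λ n → + n / suc e) d^p∸1≡) (*-/-cancelˡ e G)
  where
    G = sum (map (suc (suc e) ^_) (upTo p))
    d^p∸1≡ : suc (suc e) ^ p ∸ 1 ≡ suc e * G
    d^p∸1≡ = trans (cong (_∸ 1) (sym (geometric-sum (suc e) p))) (ℕ.m+n∸n≡m (suc e * G) 1)

module _ (d p k : ℕ) where

  private
    c₀ : ℚ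
    c₀ = + 1 / suc (d * k)

  representatives : Code d → List (Tree d)
  representatives v = deduplicateᵇ (λ t t′ → sameSet (shClass t v p) (shClass t′ v p))
                                   (filterᵇ (λ t → hasCode t v) (allC d k))

  count-representatives : ∀ t v → length (filterᵇ (λ t′ → memb t (shClass t′ v p)) (representatives v))
                                  ≡ innerSum d p k v t
  count-representatives t v = begin
    length (filterᵇ (memb t ∘ class) (representatives v))
      ≡⟨ length-map class (filterᵇ (memb t ∘ class) (representatives v)) ⟨
    length (map class (filterᵇ (memb t ∘ class) (representatives v)))
      ≡⟨ cong length (filter-map (T? ∘ memb t) class (representatives v)) ⟨
    length (filterᵇ (memb t) (map class (representatives v)))
      ≡⟨ cong (length ∘ filterᵇ (memb t)) (deduplicate-map (T? ∘₂ sameSet) class candidates) ⟨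
    innerSum d p k v t ∎
    where
      open ≡-Reasoning
      class : Tree d → List (Tree d)
      class t′ = shClass t′ v p
      candidates = filterᵇ (λ t′ → hasCode t′ v) (allC d k)

  vertexTerms : Code d → List (ℚ × Tree d × Code d)
  vertexTerms v = map (λ t → c₀ , t , v) (representatives v)

  layerTerms : ℕ → List (ℚ × Tree d × Code d)
  layerTerms i = concatMap vertexTerms (codes d (p + i))

  shuffleTerms : List (ℚ × Tree d × Code d)
  shuffleTerms = concatMap layerTerms (upTo (suc k))

  ShuffleTerm : ℚ × Tree d × Code d → Set
  ShuffleTerm (_ , t , v) = IsShuffleData d p k t v

  vertexTerms-valid : ∀ i {v} → v ∈ codes d (p + i) → All ShuffleTerm (vertexTerms v)
  vertexTerms-valid i {v} v∈ = All.map⁺ (All.tabulate λ {t} t∈ →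
    let t∈allC , hasV = ∈-filter⁻ (λ t → T? (hasCode t v)) {xs = allC d k} (∈-deduplicate⁻ _ _ t∈)
    in ∈-allC⁻ t∈allC , subst (p ≤_) (sym (length-∈-codes (p + i) v∈)) (ℕ.m≤m+n p i) ,
       Equivalence.to T-≡ hasV)

  layerTerms-valid : ∀ i → All ShuffleTerm (layerTerms i)
  layerTerms-valid i =
    All.concat⁺ {xss = map vertexTerms (codes d (p + i))} (All.map⁺ (All.tabulate (vertexTerms-valid i)))

  shuffleTerms-valid : All ShuffleTerm shuffleTerms
  shuffleTerms-valid =
    All.concat⁺ {xss = map layerTerms (upTo (suc k))} (All.map⁺ (All.tabulate λ {i} _ → layerTerms-valid i))

  shuffleWeight : Tree d → ℚ × Tree d × Code d → ℚ
  shuffleWeight t (c , t′ , v) = c ℚ.* 𝟙 (memb t (shClass t′ v p))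

  ψ-expansion : ∀ t → ψ d p k t ≡ sumℚ (map (shuffleWeight t) shuffleTerms)
  ψ-expansion t = sym (begin
    sumℚ (map weight shuffleTerms)
      ≡⟨ sumℚ-map-concatMap weight layerTerms (upTo (suc k)) ⟩
    sumℚ (map (λ i → sumℚ (map weight (layerTerms i))) (upTo (suc k)))
      ≡⟨ sumℚ-map-cong layer (upTo (suc k)) ⟩
    sumℚ (map (λ i → + layerCount i / 1 ℚ.* c₀) (upTo (suc k)))
      ≡⟨ sumℚ-map-/1 c₀ layerCount (upTo (suc k)) ⟩
    ψ d p k t ∎)
    where
      open ≡-Reasoning
      weight = shuffleWeight t

      layerCount : ℕ → ℕ
      layerCount i = sum (map (λ v → innerSum d p k v t) (codes d (p + i)))

      vertex : ∀ v → sumℚ (map weight (vertexTerms v)) ≡ + innerSum d p k v t / 1 ℚ.* c₀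
      vertex v = trans (cong sumℚ (sym (map-∘ (representatives v))))
                       (trans (sumℚ-𝟙 c₀ (λ t′ → memb t (shClass t′ v p)) (representatives v))
                              (cong (λ n → + n / 1 ℚ.* c₀) (count-representatives t v)))

      layer : ∀ i → sumℚ (map weight (layerTerms i)) ≡ + layerCount i / 1 ℚ.* c₀
      layer i = trans (sumℚ-map-concatMap weight vertexTerms (codes d (p + i)))
                      (trans (sumℚ-map-cong vertex (codes d (p + i)))
                             (sumℚ-map-/1 c₀ (λ v → innerSum d p k v t) (codes d (p + i))))

  ψ-inShuffleSpan : InShuffleSpan d p k (ψ d p k)
  ψ-inShuffleSpan = shuffleTerms , shuffleTerms-valid , λ t _ → ψ-expansion t

  shallowCount : Tree d → ℕ
  shallowCount t = sum (map (λ j → verticesAt j t) (upTo p))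

  totalSum+shallowCount : ∀ {t} → t ∈C k → totalSum d p k t + shallowCount t ≡ suc (d * k)
  totalSum+shallowCount {t} refl = begin
    totalSum d p k t + shallowCount t
      ≡⟨ cong (_+ shallowCount t) deepCount ⟩
    sum (map (λ i → verticesAt (p + i) t) (upTo (suc k))) + shallowCount t
      ≡⟨ ℕ.+-comm _ (shallowCount t) ⟩
    shallowCount t + sum (map (λ i → verticesAt (p + i) t) (upTo (suc k)))
      ≡⟨ sum-upTo-+ (λ j → verticesAt j t) p (suc k) ⟨
    sum (map (λ j → verticesAt j t) (upTo (p + suc k)))
      ≡⟨ vertexCount (p + suc k) t (ℕ.m≤n+m (suc k) p) ⟩
    suc (d * internal t) ∎
    where
      open ≡-Reasoning
      deepCount : totalSum d p k t ≡ sum (map (λ i → verticesAt (p + i) t) (upTo (suc k)))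
      deepCount = sum-map-cong (λ i → sum-map-cong (λ v → innerSum-indicator p k v refl) (codes d (p + i)))
                               (upTo (suc k))

  ψ-deviation : ∀ {t} → t ∈C k → ∣ ψ d p k t - 1ℚ ∣ ℚ.≤ + sum (map (d ^_) (upTo p)) / 1 ℚ.* c₀
  ψ-deviation {t} t∈C = deviation-bound (totalSum d p k t) (shallowCount t) (d * k) _
    (totalSum+shallowCount t∈C) (sum-map-mono (λ j → verticesAt≤ j t) (upTo p))

-- Neither 1 ≤ p nor 1 ≤ k is needed; 2 ≤ d only rules out the junk value Cdp d p = 0.
proposition6p1 : (d p k : ℕ) → 2 ≤ d → 1 ≤ p → 1 ≤ k →
    InShuffleSpan d p k (ψ d p k) ×
    (∀ (T : Tree d) → T ∈C k →
      ∣ ψ d p k T - 1ℚ ∣ ≤ℚ Cdp d p *ℚ (+ 1 / suc (d * k)))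
proposition6p1 d@(suc (suc e)) p k _ _ _ =
  ψ-inShuffleSpan d p k ,
  λ t t∈C → subst (λ C → ∣ ψ d p k t - 1ℚ ∣ ≤ℚ C *ℚ (+ 1 / suc (d * k)))
                  (sym (Cdp-geometric e p)) (ψ-deviation d p k t∈C)
proposition6p1 (suc zero) p k (s≤s ()) _ _
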